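{- For every negation normal form $A$, the formula $\mathrm{CNFtoPropF}(\mathrm{MakeCNF}(A))\to\mathrm{NNFtoPropF}(A)$ is provable in natural deduction, i.e. $[\,]\vdash\mathrm{CNFtoPropF}(\mathrm{MakeCNF}(A))\to\mathrm{NNFtoPropF}(A)$.
   Context: Fix a set $V$ of propositional variables with decidable equality. Formulas are generated by $\#p$ ($p\in V$), $\bot$, $A\wedge B$, $A\vee B$, $A\to B$; $\neg A:=A\to\bot$, $\top:=\neg\bot$. Contexts are finite lists of formulas, $A::\Gamma$ prepends $A$, $[\,]$ is the empty list. Natural deduction $\Gamma\vdash A$ is the least relation closed under: (Ax) $A$ in $\Gamma$ implies $\Gamma\vdash A$; ($\to$I) $A::\Gamma\vdash B$ implies $\Gamma\vdash A\to B$; ($\to$E) $\Gamma\vdash A\to B$ and $\Gamma\vdash A$ imply $\Gamma\vdash B$; ($\bot_c$) $\neg A::\Gamma\vdash\bot$ implies $\Gamma\vdash A$; ($\wedge$I) $\Gamma\vdash A$, $\Gamma\vdash B$ imply $\Gamma\vdash A\wedge B$; ($\wedge$E$_{1,2}$) $\Gamma\vdash A\wedge B$ implies $\Gamma\vdash A$ and $\Gamma\vdash B$; ($\vee$I$_{1,2}$) $\Gamma\vdash A$ or $\Gamma\vdash B$ implies $\Gamma\vdash A\vee B$; ($\vee$E) $\Gamma\vdash A\vee B$, $A::\Gamma\vdash C$, $B::\Gamma\vdash C$ imply $\Gamma\vdash C$. The type NNF is generated by $\mathrm{NPos}(p)$, $\mathrm{NNeg}(p)$ ($p\in V$), $\mathrm{NBot}$,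 $\mathrm{NTop}$, $\mathrm{NConj}(X,Y)$, $\mathrm{NDisj}(X,Y)$; $\mathrm{NNFtoPropF}$ sends these to $\#p$, $\neg\#p$, $\bot$, $\top$, $X'\wedge Y'$, $X'\vee Y'$. Literals are $\mathrm{LPos}(p)$, $\mathrm{LNeg}(p)$, $\mathrm{LBot}$, $\mathrm{LTop}$, mapped to $\#p,\neg\#p,\bot,\top$. A clause is a finite list of literals; a CNF is a finite list of clauses. $\mathrm{ClausetoPropF}([\,])=\bot$, $\mathrm{ClausetoPropF}(l::c)=l'\vee\mathrm{ClausetoPropF}(c)$; $\mathrm{CNFtoPropF}([\,])=\top$, $\mathrm{CNFtoPropF}(c::ll)=\mathrm{ClausetoPropF}(c)\wedge\mathrm{CNFtoPropF}(ll)$. $\mathrm{AddClause}(c,ll)$ replaces each clause $c_2$ of $ll$ by $c\mathbin{++}c_2$; $\mathrm{Disjunct}(ll_1,ll_2)$ is the concatenation over clauses $c$ of $ll_1$ (in order) of $\mathrm{AddClause}(c,ll_2)$. $\mathrm{MakeCNF}$: $\mathrm{NPos}(p)\mapsto[[\mathrm{LPos}(p)]]$, $\mathrm{NNeg}(p)\mapsto[[\mathrm{LNeg}(p)]]$, $\mathrm{NBot}\mapsto[[\mathrm{LBot}]]$, $\mathrm{NTop}\mapsto[[\mathrm{LTop}]]$, $\mathrm{NConj}(B,C)\mapsto\mathrm{MakeCNF}(B)\mathbin{++}\mathrm{MakeCNF}(C)$, $\mathrm{NDisj}(B,C)\mapsto\mathrm{Disjunct}(\mathrm{MakeCNF}(B),\mathrm{MakeCNF}(C))$.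 -}

module Defs where

open import Data.List using (List; []; _∷_; _++_; map; concatMap)
open import Data.List.Membership.Propositional using (_∈_)
open import Relation.Binary.Definitions using (DecidableEquality)

module Logic {V : Set} (_≟V_ : DecidableEquality V) where

  infixr 6 _∧'_
  infixr 5 _∨'_
  infixr 4 _⇒_

  data PropF : Set where
    #_   : V → PropF
    ⊥'   : PropF
    _∧'_ : PropF → PropF → PropF
    _∨'_ : PropF → PropF → PropF
    _⇒_  : PropF → PropF → PropF

  ¬'_ : PropF → PropF
  ¬' A = A ⇒ ⊥'

  ⊤' : PropF
  ⊤' = ¬' ⊥'

  Ctx : Set
  Ctx = List PropF

  infix 3 _⊢_
  data _⊢_ : Ctx → PropF → Set where
    Ax    : ∀ {Γ A} → A ∈ Γ → Γ ⊢ A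
    ImpI  : ∀ {Γ A B} → (A ∷ Γ) ⊢ B → Γ ⊢ A ⇒ B
    ImpE  : ∀ {Γ A B} → Γ ⊢ A ⇒ B → Γ ⊢ A → Γ ⊢ B
    BotC  : ∀ {Γ A} → ((¬' A) ∷ Γ) ⊢ ⊥' → Γ ⊢ A
    AndI  : ∀ {Γ A B} → Γ ⊢ A → Γ ⊢ B → Γ ⊢ A ∧' B
    AndE1 : ∀ {Γ A B} → Γ ⊢ A ∧' B → Γ ⊢ A
    AndE2 : ∀ {Γ A B} → Γ ⊢ A ∧' B → Γ ⊢ B
    OrI1  : ∀ {Γ A B} → Γ ⊢ A → Γ ⊢ A ∨' B
    OrI2  : ∀ {Γ A B} → Γ ⊢ B → Γ ⊢ A ∨' B
    OrE   : ∀ {Γ A B C} → Γ ⊢ A ∨' B → (A ∷ Γ) ⊢ C → (B ∷ Γ) ⊢ C → Γ ⊢ C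

  data NNF : Set where
    NPos NNeg : V → NNF
    NBot NTop : NNF
    NConj NDisj : NNF → NNF → NNF

  NNFtoPropF : NNF → PropF
  NNFtoPropF (NPos p) = # p
  NNFtoPropF (NNeg p) = ¬' (# p)
  NNFtoPropF NBot = ⊥'
  NNFtoPropF NTop = ⊤'
  NNFtoPropF (NConj X Y) = NNFtoPropF X ∧' NNFtoPropF Y
  NNFtoPropF (NDisj X Y) = NNFtoPropF X ∨' NNFtoPropF Y

  data Literal : Set where
    LPos LNeg : V → Literal
    LBot LTop : Literal

  LiteraltoPropF : Literal → PropF
  LiteraltoPropF (LPos p) = # p
  LiteraltoPropF (LNeg p) = ¬' (# p)
  LiteraltoPropF LBot = ⊥'
  LiteraltoPropF LTop = ⊤'

  Clause : Set
  Clause = List Literal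

  CNF : Set
  CNF = List Clause

  ClausetoPropF : Clause → PropF
  ClausetoPropF [] = ⊥'
  ClausetoPropF (l ∷ c) = LiteraltoPropF l ∨' ClausetoPropF c

  CNFtoPropF : CNF → PropF
  CNFtoPropF [] = ⊤'
  CNFtoPropF (c ∷ ll) = ClausetoPropF c ∧' CNFtoPropF ll

  AddClause : Clause → CNF → CNF
  AddClause c ll = map (c ++_) ll

  Disjunct : CNF → CNF → CNF
  Disjunct ll₁ ll₂ = concatMap (λ c → AddClause c ll₂) ll₁

  MakeCNF : NNF → CNF
  MakeCNF (NPos p) = (LPos p ∷ []) ∷ []
  MakeCNF (NNeg p) = (LNeg p ∷ []) ∷ []
  MakeCNF NBot = (LBot ∷ []) ∷ []
  MakeCNF NTop = (LTop ∷ []) ∷ []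
  MakeCNF (NConj B C) = MakeCNF B ++ MakeCNF C
  MakeCNF (NDisj B C) = Disjunct (MakeCNF B) (MakeCNF C)

module Submission where

-- The argument is by induction on the NNF A, working with derivations in an
-- arbitrary context Γ so that the induction hypothesis can be applied to the
-- assumption introduced by ∨-elimination.  Three syntactic facts about the
-- translation are needed, each reflecting a propositional law:
--   * a CNF of the form ll₁ ++ ll₂ yields both CNF ll₁ and CNF ll₂;
--   * a clause c₁ ++ c₂ yields c₁ ∨ c₂ (associativity of ∨);
--   * the CNF Disjunct ll₁ ll₂ yields CNF ll₁ ∨ CNF ll₂ (distributivity of
--     ∨ over ∧, applied once per pair of clauses).

open import Defs
open import Data.List using ([]; _∷_; _++_)
open import Data.List.Relation.Unary.Any using (here)
open import Data.List.Relation.Binary.Subset.Propositional using (_⊆_)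
open import Data.List.Relation.Binary.Subset.Propositional.Properties
  using (∷⁺ʳ; xs⊆x∷xs)
open import Data.Product using (_×_; _,_)
open import Relation.Binary.Definitions using (DecidableEquality)
open import Relation.Binary.PropositionalEquality using (refl)

module CNFSoundness {V : Set} (dec : DecidableEquality V) where
  open Logic dec

  weaken : ∀ {Γ Δ A} → Γ ⊆ Δ → Γ ⊢ A → Δ ⊢ A
  weaken ρ (Ax x)      = Ax (ρ x)
  weaken ρ (ImpI d)    = ImpI (weaken (∷⁺ʳ _ ρ) d)
  weaken ρ (ImpE d e)  = ImpE (weaken ρ d) (weaken ρ e)
  weaken ρ (BotC d)    = BotC (weaken (∷⁺ʳ _ ρ) d)
  weaken ρ (AndI d e)  = AndI (weaken ρ d) (weaken ρ e)
  weaken ρ (AndE1 d)   = AndE1 (weaken ρ d)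
  weaken ρ (AndE2 d)   = AndE2 (weaken ρ d)
  weaken ρ (OrI1 d)    = OrI1 (weaken ρ d)
  weaken ρ (OrI2 d)    = OrI2 (weaken ρ d)
  weaken ρ (OrE d e f) = OrE (weaken ρ d) (weaken (∷⁺ʳ _ ρ) e) (weaken (∷⁺ʳ _ ρ) f)

  weaken₁ : ∀ {Γ A B} → Γ ⊢ A → (B ∷ Γ) ⊢ A
  weaken₁ = weaken (xs⊆x∷xs _ _)

  hyp : ∀ {Γ A} → (A ∷ Γ) ⊢ A
  hyp = Ax (here refl)

  ⊤-intro : ∀ {Γ} → Γ ⊢ ⊤'
  ⊤-intro = ImpI hyp

  ⊥-elim' : ∀ {Γ A} → Γ ⊢ ⊥' → Γ ⊢ A
  ⊥-elim' d = BotC (weaken₁ d)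

  ∨-map : ∀ {Γ A B A' B'} → Γ ⊢ A ∨' B → (A ∷ Γ) ⊢ A' → (B ∷ Γ) ⊢ B' → Γ ⊢ A' ∨' B'
  ∨-map d f g = OrE d (OrI1 f) (OrI2 g)

  ∨-comm : ∀ {Γ A B} → Γ ⊢ A ∨' B → Γ ⊢ B ∨' A
  ∨-comm d = OrE d (OrI2 hyp) (OrI1 hyp)

  ∨-assocˡ : ∀ {Γ A B C} → Γ ⊢ A ∨' (B ∨' C) → Γ ⊢ (A ∨' B) ∨' C
  ∨-assocˡ d = OrE d (OrI1 (OrI1 hyp)) (∨-map hyp (OrI2 hyp) hyp)

  ∨-⊥ʳ : ∀ {Γ A} → Γ ⊢ A ∨' ⊥' → Γ ⊢ A
  ∨-⊥ʳ d = OrE d hyp (⊥-elim' hyp)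

  ∨-distribˡ-∧ : ∀ {Γ A B C} → Γ ⊢ C ∨' A → Γ ⊢ C ∨' B → Γ ⊢ C ∨' (A ∧' B)
  ∨-distribˡ-∧ d e = OrE d (OrI1 hyp) (∨-map (weaken₁ e) hyp (AndI (weaken₁ hyp) hyp))

  ∨-distribʳ-∧ : ∀ {Γ A B C} → Γ ⊢ A ∨' C → Γ ⊢ B ∨' C → Γ ⊢ (A ∧' B) ∨' C
  ∨-distribʳ-∧ d e = ∨-comm (∨-distribˡ-∧ (∨-comm d) (∨-comm e))

  CNF-++ : ∀ {Γ} ll₁ ll₂ → Γ ⊢ CNFtoPropF (ll₁ ++ ll₂) →
           (Γ ⊢ CNFtoPropF ll₁) × (Γ ⊢ CNFtoPropF ll₂)
  CNF-++ []       ll₂ d = ⊤-intro , d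
  CNF-++ (c ∷ ll₁) ll₂ d with CNF-++ ll₁ ll₂ (AndE2 d)
  ... | d₁ , d₂ = AndI (AndE1 d) d₁ , d₂

  Clause-++ : ∀ {Γ} c₁ c₂ → Γ ⊢ ClausetoPropF (c₁ ++ c₂) →
              Γ ⊢ ClausetoPropF c₁ ∨' ClausetoPropF c₂
  Clause-++ []       c₂ d = OrI2 d
  Clause-++ (l ∷ c₁) c₂ d = ∨-assocˡ (∨-map d hyp (Clause-++ c₁ c₂ hyp))

  CNF-AddClause : ∀ {Γ} c ll → Γ ⊢ CNFtoPropF (AddClause c ll) →
                  Γ ⊢ ClausetoPropF c ∨' CNFtoPropF ll
  CNF-AddClause c []         d = OrI2 ⊤-intro
  CNF-AddClause c (c₂ ∷ ll) d =
    ∨-distribˡ-∧ (Clause-++ c c₂ (AndE1 d)) (CNF-AddClause c ll (AndE2 d))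

  CNF-Disjunct : ∀ {Γ} ll₁ ll₂ → Γ ⊢ CNFtoPropF (Disjunct ll₁ ll₂) →
                 Γ ⊢ CNFtoPropF ll₁ ∨' CNFtoPropF ll₂
  CNF-Disjunct []        ll₂ d = OrI1 ⊤-intro
  CNF-Disjunct (c ∷ ll₁) ll₂ d with CNF-++ (AddClause c ll₂) (Disjunct ll₁ ll₂) d
  ... | d₁ , d₂ = ∨-distribʳ-∧ (CNF-AddClause c ll₂ d₁) (CNF-Disjunct ll₁ ll₂ d₂)

  CNF-unit : ∀ {Γ} l → Γ ⊢ CNFtoPropF ((l ∷ []) ∷ []) → Γ ⊢ LiteraltoPropF l
  CNF-unit l d = ∨-⊥ʳ (AndE1 d)

  MakeCNF-sound : ∀ {Γ} A → Γ ⊢ CNFtoPropF (MakeCNF A) → Γ ⊢ NNFtoPropF A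
  MakeCNF-sound (NPos p)    = CNF-unit (LPos p)
  MakeCNF-sound (NNeg p)    = CNF-unit (LNeg p)
  MakeCNF-sound NBot        = CNF-unit LBot
  MakeCNF-sound NTop        = CNF-unit LTop
  MakeCNF-sound (NConj A B) d with CNF-++ (MakeCNF A) (MakeCNF B) d
  ... | dA , dB = AndI (MakeCNF-sound A dA) (MakeCNF-sound B dB)
  MakeCNF-sound (NDisj A B) d =
    ∨-map (CNF-Disjunct (MakeCNF A) (MakeCNF B) d) (MakeCNF-sound A hyp) (MakeCNF-sound B hyp)

mainTheorem7 : {V : Set} (dec : DecidableEquality V) → let open Logic dec in
    (A : NNF) → [] ⊢ CNFtoPropF (MakeCNF A) ⇒ NNFtoPropF A
mainTheorem7 dec A = ImpI (MakeCNF-sound A hyp)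
  where open Logic dec
        open CNFSoundness dec
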